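{- For every integer $n\ge 8$, $\beta_b(C(n;1,4))=\alpha(C(n;1,4))=\left\lfloor\frac{2n}{5}\right\rfloor$.
   Context: For integers $n\ge 3$ and $1\le a\le\lfloor n/2\rfloor$, the circulant graph $C(n;1,a)$ has vertex set $\{v_0,\dots,v_{n-1}\}$ and edges $v_iv_{i+1}$ and $v_iv_{i+a}$, subscripts modulo $n$. For a connected graph $G$, a broadcast is a function $f:V(G)\to\{0,\dots,\mathrm{diam}(G)\}$ with $f(v)\le e(v)$ (eccentricity) for all $v$; $V_f^+=\{v:f(v)>0\}$. $f$ is independent if $d(u,v)>\max\{f(u),f(v)\}$ for all distinct $u,v\in V_f^+$. The cost is $\sigma(f)=\sum_v f(v)$, and $\beta_b(G)$ is the maximum cost of an independent broadcast on $G$. $\alpha(G)$ denotes the independence number. -}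

module Defs where

open import Data.Nat using (ℕ; zero; suc; _+_; _≤_; _<_; _⊔_)
open import Data.Fin using (Fin; toℕ)
open import Data.Fin.Subset using (Subset; _∈_; ∣_∣)
open import Data.List using (tabulate)
open import Data.Nat.ListAction using (sum)
open import Data.Product using (Σ; _×_; ∃)
open import Data.Sum using (_⊎_)
open import Relation.Binary.PropositionalEquality using (_≡_; _≢_)
open import Relation.Nullary using (¬_)

-- j ≡ i + s (mod n), for 0 ≤ s < n : either i + s = j or i + s = j + n.
PlusStep : (n s : ℕ) → Fin n → Fin n → Set
PlusStep n s i j = (toℕ i + s ≡ toℕ j) ⊎ (toℕ i + s ≡ toℕ j + n)

CircAdj : (n a : ℕ) → Fin n → Fin n → Set
CircAdj n a i j =
  PlusStep n 1 i j ⊎ PlusStep n 1 j i ⊎ PlusStep n a i j ⊎ PlusStep n a j i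

module _ {n : ℕ} (E : Fin n → Fin n → Set) where

  data Reach : ℕ → Fin n → Fin n → Set where
    here : ∀ {u} → Reach zero u u
    stay : ∀ {k u v} → Reach k u v → Reach (suc k) u v
    step : ∀ {k u w v} → Reach k u w → E w v → Reach (suc k) u v

  Dist : Fin n → Fin n → ℕ → Set
  Dist u v m = Reach m u v × (∀ k → k < m → ¬ Reach k u v)

  Ecc : Fin n → ℕ → Set
  Ecc v m = (∀ u d → Dist v u d → d ≤ m) × (∃ λ u → Dist v u m)

  Diam : ℕ → Set
  Diam m = (∀ v e → Ecc v e → e ≤ m) × (∃ λ v → Ecc v m)

  -- a broadcast: f(v) ≤ e(v) for all v (this also gives f(v) ≤ diam(G))
  IsBroadcast : (Fin n → ℕ) → Set
  IsBroadcast f = ∀ v e → Ecc v e → f v ≤ e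

  IsIndependentBroadcast : (Fin n → ℕ) → Set
  IsIndependentBroadcast f =
    IsBroadcast f ×
    (∀ u v → u ≢ v → 0 < f u → 0 < f v →
       ∀ m → Dist u v m → f u ⊔ f v < m)

  cost : (Fin n → ℕ) → ℕ
  cost f = sum (tabulate f)

  BroadcastIndependenceNumber : ℕ → Set
  BroadcastIndependenceNumber k =
    (Σ (Fin n → ℕ) λ f → IsIndependentBroadcast f × cost f ≡ k) ×
    (∀ f → IsIndependentBroadcast f → cost f ≤ k)

  IsIndependentSet : Subset n → Set
  IsIndependentSet S = ∀ u v → u ∈ S → v ∈ S → u ≢ v → ¬ E u v

  IndependenceNumber : ℕ → Set
  IndependenceNumber k =
    (Σ (Subset n) λ S → IsIndependentSet S × ∣ S ∣ ≡ k) ×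
    (∀ S → IsIndependentSet S → ∣ S ∣ ≤ k)

{-# OPTIONS --safe #-}
-- Let N = ⌊2n/5⌋.  For the lower bound take the evenly spread set of those i with
-- ⌊(i+1)N/n⌋ > ⌊iN/n⌋: it has N elements, and since 5N ≤ 2n ≤ 6N (for n ≥ 8) no two of
-- them differ by 1 or 4 modulo n, so it is independent and its characteristic function is
-- an independent broadcast of cost N.  For the upper bound, steps of ±1 and ±4 carry i to
-- i + g in about g/4 steps, so every vertex is within distance N of every other.  A vertex
-- of strength above n/5 then forces all other vertices to be silent, and its strength is at
-- most its eccentricity, hence at most N.  If all strengths are at most n/5, a double
-- count of charges gives 5σ(f) ≤ 2n.
module Submission where

open import Defs
open import Data.Empty using (⊥; ⊥-elim)
open import Data.Fin as Fin using (Fin; toℕ)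
import Data.Fin.Properties as Fin
open import Data.Fin.Subset using (Subset; Side; inside; outside; _∈_; ∣_∣)
open import Data.List using (tabulate)
open import Data.Nat
open import Data.Nat.DivMod
open import Data.Nat.Divisibility using (divides)
open import Data.Nat.ListAction using (sum)
open import Data.Nat.Properties
open import Data.Nat.Tactic.RingSolver using (solve-∀)
open import Data.Product using (∃; _×_; _,_; proj₁)
open import Data.Sum using (_⊎_; inj₁; inj₂)
open import Data.Vec as Vec using ([]; _∷_; lookup)
open import Data.Vec.Properties using (lookup∘tabulate; lookup⇒[]=; []=⇒lookup)
open import Function using (_∘_; const)
open import Relation.Binary.PropositionalEquality
open import Relation.Nullary using (¬_; yes; no)
open import Relation.Nullary.Decidable using (decidable-stable)

open import Algebra.Properties.CommutativeSemigroup +-commutativeSemigroup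
  using (interchange; xy∙z≈xz∙y)

%-of-<2* : ∀ {a} n .{{_ : NonZero n}} → a < n + n → a % n ≡ a ⊎ a % n + n ≡ a
%-of-<2* {a} n a<2n with a <? n
... | yes a<n = inj₁ (m<n⇒m%n≡m a<n)
... | no  a≮n = inj₂ (begin
  a % n + n           ≡⟨ cong (λ x → x % n + n) (m∸n+n≡m n≤a) ⟨
  (a ∸ n + n) % n + n ≡⟨ cong (_+ n) ([m+n]%n≡m%n (a ∸ n) n) ⟩
  (a ∸ n) % n + n     ≡⟨ cong (_+ n) (m<n⇒m%n≡m (m<n+o⇒m∸n<o a n a<2n)) ⟩
  a ∸ n + n           ≡⟨ m∸n+n≡m n≤a ⟩
  a                   ∎)
  where
  open ≡-Reasoning
  n≤a : n ≤ a
  n≤a = ≮⇒≥ a≮n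

*≤⇒≤/ : ∀ {k m} d .{{_ : NonZero d}} → k * d ≤ m → k ≤ m / d
*≤⇒≤/ {k} d k*d≤m = subst (_≤ _) (m*n/n≡m k d) (/-monoˡ-≤ d k*d≤m)

≤/⇒*≤ : ∀ {k m} d .{{_ : NonZero d}} → k ≤ m / d → k * d ≤ m
≤/⇒*≤ {m = m} d k≤m/d = ≤-trans (*-monoˡ-≤ d k≤m/d) (m/n*n≤m m d)

n≤3*[2n/5] : ∀ {n} → 8 ≤ n → n ≤ 3 * (2 * n / 5)
n≤3*[2n/5] {n} 8≤n = subst (λ n → n ≤ 3 * (2 * n / 5)) (m+[n∸m]≡n 8≤n) (from8 (n ∸ 8))
  where
  from10 : ∀ n → 10 ≤ n → n ≤ 3 * (2 * n / 5)
  from10 n 10≤n = *-cancelˡ-≤ 2 (begin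
    2 * n               ≡⟨ m≡m%n+[m/n]*n (2 * n) 5 ⟩
    (2 * n) % 5 + N * 5 ≤⟨ +-monoˡ-≤ (N * 5) (≤-trans (≤-pred (m%n<n (2 * n) 5)) 4≤N) ⟩
    N + N * 5           ≡⟨ regroup N ⟩
    2 * (3 * N)         ∎)
    where
    open ≤-Reasoning
    N = 2 * n / 5
    4≤N : 4 ≤ N
    4≤N = *≤⇒≤/ 5 (*-monoʳ-≤ 2 10≤n)
    regroup : ∀ N → N + N * 5 ≡ 2 * (3 * N)
    regroup = solve-∀
  from8 : ∀ m → 8 + m ≤ 3 * (2 * (8 + m) / 5)
  from8 0               = n≤1+n 8
  from8 1               = ≤-refl
  from8 (suc (suc m)) = from10 (10 + m) (m≤m+n 10 m)

-- Sums over initial segments of ℕ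

sum< : ℕ → (ℕ → ℕ) → ℕ
sum< zero    h = 0
sum< (suc m) h = h 0 + sum< m (h ∘ suc)

syntax sum< m (λ i → e) = ∑[ i < m ] e

sum<-snoc : ∀ m h → sum< (suc m) h ≡ sum< m h + h m
sum<-snoc zero    h = +-comm (h 0) 0
sum<-snoc (suc m) h =
  trans (cong (h 0 +_) (sum<-snoc m (h ∘ suc))) (sym (+-assoc (h 0) _ _))

sum<-cong : ∀ m {g h} → (∀ i → i < m → g i ≡ h i) → sum< m g ≡ sum< m h
sum<-cong zero    _   = refl
sum<-cong (suc m) g≡h =
  cong₂ _+_ (g≡h 0 z<s) (sum<-cong m (λ i i<m → g≡h (suc i) (s<s i<m)))

sum<-mono-≤ : ∀ m {g h} → (∀ i → i < m → g i ≤ h i) → sum< m g ≤ sum< m h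
sum<-mono-≤ zero    _   = z≤n
sum<-mono-≤ (suc m) g≤h =
  +-mono-≤ (g≤h 0 z<s) (sum<-mono-≤ m (λ i i<m → g≤h (suc i) (s<s i<m)))

sum<-monoˡ-≤ : ∀ h {m m'} → m ≤ m' → sum< m h ≤ sum< m' h
sum<-monoˡ-≤ h m≤m' = go (≤⇒≤′ m≤m')
  where
  go : ∀ {m m'} → m ≤′ m' → sum< m h ≤ sum< m' h
  go ≤′-refl                   = ≤-refl
  go {m} (≤′-step {n = m'} m≤′m') = begin
    sum< m h         ≤⟨ go m≤′m' ⟩
    sum< m' h        ≤⟨ m≤m+n _ (h m') ⟩
    sum< m' h + h m' ≡⟨ sum<-snoc m' h ⟨
    sum< (suc m') h  ∎
    where open ≤-Reasoning

sum<-const : ∀ m c → sum< m (const c) ≡ m * c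
sum<-const zero    c = refl
sum<-const (suc m) c = cong (c +_) (sum<-const m c)

sum<-distrib-+ : ∀ m g h → sum< m (λ i → g i + h i) ≡ sum< m g + sum< m h
sum<-distrib-+ zero    g h = refl
sum<-distrib-+ (suc m) g h =
  trans (cong (g 0 + h 0 +_) (sum<-distrib-+ m (g ∘ suc) (h ∘ suc)))
        (interchange (g 0) (h 0) _ _)

*-distribˡ-sum< : ∀ m c h → c * sum< m h ≡ sum< m (λ i → c * h i)
*-distribˡ-sum< zero    c h = *-zeroʳ c
*-distribˡ-sum< (suc m) c h =
  trans (*-distribˡ-+ c (h 0) _) (cong (c * h 0 +_) (*-distribˡ-sum< m c (h ∘ suc)))

sum<-comm : ∀ m k (c : ℕ → ℕ → ℕ) →
  ∑[ y < m ] sum< k (c y) ≡ ∑[ j < k ] ∑[ y < m ] c y j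
sum<-comm zero    k c = sym (trans (sum<-const k 0) (*-zeroʳ k))
sum<-comm (suc m) k c =
  trans (cong (sum< k (c 0) +_) (sum<-comm m k (c ∘ suc)))
        (sym (sum<-distrib-+ k (c 0) (λ j → ∑[ y < m ] c (suc y) j)))

sum<-rotate : ∀ m h → (∀ i → h (i + m) ≡ h i) → ∀ j → ∑[ i < m ] h (i + j) ≡ sum< m h
sum<-rotate m h periodic zero    = sum<-cong m (λ i _ → cong h (+-identityʳ i))
sum<-rotate m h periodic (suc j) = begin
  ∑[ i < m ] h (i + suc j)   ≡⟨ sum<-cong m (λ i _ → cong h (+-suc i j)) ⟩
  ∑[ i < m ] h (suc i + j)   ≡⟨ +-cancelˡ-≡ (h j) _ _ rotate-once ⟩
  ∑[ i < m ] h (i + j)       ≡⟨ sum<-rotate m h periodic j ⟩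
  sum< m h                   ∎
  where
  open ≡-Reasoning
  rotate-once : h j + ∑[ i < m ] h (suc i + j) ≡ h j + ∑[ i < m ] h (i + j)
  rotate-once = begin
    sum< (suc m) (λ i → h (i + j))          ≡⟨ sum<-snoc m (λ i → h (i + j)) ⟩
    ∑[ i < m ] h (i + j) + h (m + j)        ≡⟨ cong (λ x → ∑[ i < m ] h (i + j) + h x) (+-comm m j) ⟩
    ∑[ i < m ] h (i + j) + h (j + m)        ≡⟨ cong (∑[ i < m ] h (i + j) +_) (periodic j) ⟩
    ∑[ i < m ] h (i + j) + h j              ≡⟨ +-comm _ (h j) ⟩
    h j + ∑[ i < m ] h (i + j)              ∎

sum-tabulate : ∀ {m} (f : Fin m → ℕ) h → (∀ i → f i ≡ h (toℕ i)) →
  sum (tabulate f) ≡ sum< m h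
sum-tabulate {zero}  f h f≡h = refl
sum-tabulate {suc m} f h f≡h =
  cong₂ _+_ (f≡h Fin.zero) (sum-tabulate (f ∘ Fin.suc) (h ∘ suc) (f≡h ∘ Fin.suc))

sum-tabulate-single : ∀ {m} (f : Fin m → ℕ) p → (∀ q → q ≢ p → f q ≡ 0) →
  sum (tabulate f) ≡ f p
sum-tabulate-single {suc m} f Fin.zero others = begin
  f Fin.zero + sum (tabulate (f ∘ Fin.suc)) ≡⟨ cong (f Fin.zero +_) rest ⟩
  f Fin.zero + 0                            ≡⟨ +-identityʳ _ ⟩
  f Fin.zero                                ∎
  where
  open ≡-Reasoning
  rest : sum (tabulate (f ∘ Fin.suc)) ≡ 0
  rest = trans (sum-tabulate (f ∘ Fin.suc) (const 0) (λ q → others (Fin.suc q) λ ()))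
               (trans (sum<-const m 0) (*-zeroʳ m))
sum-tabulate-single {suc m} f (Fin.suc p) others =
  cong₂ _+_ (others Fin.zero λ ())
            (sum-tabulate-single (f ∘ Fin.suc) p
              (λ q q≢p → others (Fin.suc q) (q≢p ∘ Fin.suc-injective)))

indicator : ℕ → ℕ → ℕ → ℕ
indicator a b j with a ≤? j | j <? b
... | yes _ | yes _ = 1
... | _     | _     = 0

indicator≤1 : ∀ a b j → indicator a b j ≤ 1
indicator≤1 a b j with a ≤? j | j <? b
... | yes _ | yes _ = ≤-refl
... | yes _ | no  _ = z≤n
... | no  _ | _     = z≤n

indicator-pos : ∀ {a b j} → 0 < indicator a b j → a ≤ j × j < b
indicator-pos {a} {b} {j} pos with a ≤? j | j <? b
... | yes a≤j | yes j<b = a≤j , j<b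

sum<-indicator : ∀ a b m → m ≤ b → sum< m (indicator a b) ≡ m ∸ a
sum<-indicator a b zero    _   = sym (0∸n≡0 a)
sum<-indicator a b (suc m) m<b = begin
  sum< (suc m) (indicator a b)          ≡⟨ sum<-snoc m (indicator a b) ⟩
  sum< m (indicator a b) + indicator a b m
                                         ≡⟨ cong (_+ indicator a b m) (sum<-indicator a b m (<⇒≤ m<b)) ⟩
  m ∸ a + indicator a b m                ≡⟨ last-step ⟩
  suc m ∸ a                              ∎
  where
  open ≡-Reasoning
  last-step : m ∸ a + indicator a b m ≡ suc m ∸ a
  last-step with a ≤? m | m <? b
  ... | _       | no m≮b = ⊥-elim (m≮b m<b)
  ... | yes a≤m | yes _  = trans (+-comm (m ∸ a) 1) (sym (+-∸-assoc 1 a≤m))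
  ... | no a≰m  | yes _  =
    trans (+-identityʳ _) (trans (m≤n⇒m∸n≡0 (<⇒≤ (≰⇒> a≰m))) (sym (m≤n⇒m∸n≡0 (≰⇒> a≰m))))

sum<-last-support : ∀ m h → (∀ i → h i ≤ 1) → ∀ c → c < sum< m h →
  ∃ λ j → j < m × 0 < h j × c ≤ sum< j h
sum<-last-support zero    h h≤1 c ()
sum<-last-support (suc m) h h≤1 c c<sum with h m in hm
... | zero  = let j , j<m , h[j]>0 , c≤ = sum<-last-support m h h≤1 c c<sum[m]
              in  j , m<n⇒m<1+n j<m , h[j]>0 , c≤
  where
  c<sum[m] : c < sum< m h
  c<sum[m] = subst (c <_) (trans (sum<-snoc m h) (trans (cong (sum< m h +_) hm) (+-identityʳ _))) c<sum
... | suc _ = m , ≤-refl , subst (0 <_) (sym hm) z<s , ≤-pred (begin-strict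
    c                 <⟨ c<sum ⟩
    sum< (suc m) h    ≡⟨ sum<-snoc m h ⟩
    sum< m h + h m    ≤⟨ +-monoʳ-≤ (sum< m h) (h≤1 m) ⟩
    sum< m h + 1      ≡⟨ +-comm _ 1 ⟩
    suc (sum< m h)    ∎)
  where open ≤-Reasoning

-- Broadcasts on an arbitrary graph

module _ {P : ℕ → Set} (P-suc : ∀ {k} → P k → P (suc k)) where

  upward-closed : ∀ {k l} → k ≤ l → P k → P l
  upward-closed k≤l p = go (≤⇒≤′ k≤l)
    where
    go : ∀ {l} → _ ≤′ l → P l
    go ≤′-refl          = p
    go (≤′-step k≤′l) = P-suc (go k≤′l)

  ¬¬-least : ∀ l → P l → ¬ ¬ ∃ λ m → P m × (∀ k → k < m → ¬ P k)
  ¬¬-least zero    p₀ none = none (0 , p₀ , λ _ ())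
  ¬¬-least (suc l) pₗ none =
    none (suc l , pₗ , λ k k≤l pₖ → ¬¬-least l (upward-closed (≤-pred k≤l) pₖ) none)

¬¬-∀-Fin : ∀ {m} {P : Fin m → Set} → (∀ i → ¬ ¬ P i) → ¬ ¬ (∀ i → P i)
¬¬-∀-Fin {zero}          _   all = all λ ()
¬¬-∀-Fin {suc m} {P} ¬¬P all = ¬¬P Fin.zero λ p₀ →
  ¬¬-∀-Fin {P = P ∘ Fin.suc} (¬¬P ∘ Fin.suc) λ ps →
    all λ { Fin.zero → p₀ ; (Fin.suc i) → ps i }

fromSide : Side → ℕ
fromSide inside  = 1
fromSide outside = 0

fromSide≤1 : ∀ s → fromSide s ≤ 1
fromSide≤1 inside  = ≤-refl
fromSide≤1 outside = z≤n

characteristic : ∀ {n} → Subset n → Fin n → ℕ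
characteristic S i = fromSide (lookup S i)

sum-characteristic : ∀ {n} (S : Subset n) → sum (tabulate (characteristic S)) ≡ ∣ S ∣
sum-characteristic []            = refl
sum-characteristic (inside  ∷ S) = cong suc (sum-characteristic S)
sum-characteristic (outside ∷ S) = sum-characteristic S

characteristic-pos⇒∈ : ∀ {n} (S : Subset n) {i} → 0 < characteristic S i → i ∈ S
characteristic-pos⇒∈ S {i} pos with lookup S i in eq
... | inside = lookup⇒[]= i S eq

positive : ℕ → Side
positive zero    = outside
positive (suc _) = inside

fromSide-positive : ∀ {x} → x ≤ 1 → fromSide (positive x) ≡ x
fromSide-positive {zero}  _             = refl
fromSide-positive {suc zero} _          = refl
fromSide-positive {suc (suc _)} (s≤s ())

module _ {n : ℕ} {E : Fin n → Fin n → Set} where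

  reach-zero : ∀ {u v} → Reach E 0 u v → u ≡ v
  reach-zero here = refl

  reach-mono : ∀ {k l u v} → k ≤ l → Reach E k u v → Reach E l u v
  reach-mono = upward-closed stay

  dist≤reach : ∀ {k d u v} → Reach E k u v → Dist E u v d → d ≤ k
  dist≤reach r (_ , minimal) = ≮⇒≥ λ k<d → minimal _ k<d r

  ¬¬dist : ∀ {l u v} → Reach E l u v → ¬ ¬ ∃ (Dist E u v)
  ¬¬dist = ¬¬-least stay _

  adjacent⇒dist1 : ∀ {u v} → u ≢ v → E u v → Dist E u v 1
  adjacent⇒dist1 u≢v uv = step here uv , λ { zero _ r → u≢v (reach-zero r) ; (suc _) (s≤s ()) _ }

  independent-reach : ∀ {f} → IsIndependentBroadcast E f →
    ∀ {l u v} → u ≢ v → 0 < f u → 0 < f v → Reach E l u v → f u ⊔ f v < l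
  independent-reach (_ , separated) u≢v fu fv r =
    decidable-stable (_ <? _) λ ≮l → ¬¬dist r λ (d , dist) →
      ≮l (<-≤-trans (separated _ _ u≢v fu fv d dist) (dist≤reach r dist))

  ¬¬farthest : ∀ {m v} → (∀ u → Reach E m v u) → (∀ k → k < m → ¬ (∀ u → Reach E k v u)) →
    ¬ ¬ ∃ λ u → Dist E v u m
  ¬¬farthest {zero}  {v} _   _     none = none (v , here , λ _ ())
  ¬¬farthest {suc m}     all least none = ¬¬-∀-Fin unreachable-in-m (least m ≤-refl)
    where
    unreachable-in-m : ∀ u → ¬ ¬ Reach E m _ u
    unreachable-in-m u ¬r = none (u , all u , λ k k≤m r → ¬r (reach-mono (≤-pred k≤m) r))

  ¬¬eccentricity : ∀ {r v} → (∀ u → Reach E r v u) → ¬ ¬ ∃ λ e → e ≤ r × Ecc E v e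
  ¬¬eccentricity all none = ¬¬-least (λ reach u → stay (reach u)) _ all λ (m , reach , least) →
    ¬¬farthest reach least λ far →
      none (m , ≮⇒≥ (λ r<m → least _ r<m all) , (λ u d → dist≤reach (reach u)) , far)

  broadcast≤radius : ∀ {f r v} → IsBroadcast E f → (∀ u → Reach E r v u) → f v ≤ r
  broadcast≤radius {f} {r} {v} broadcast all = decidable-stable (f v ≤? r) λ f≰r →
    ¬¬eccentricity all λ (e , e≤r , ecc) → f≰r (≤-trans (broadcast v e ecc) e≤r)

  characteristic-independent : (∀ v → ∃ λ u → v ≢ u × E v u) →
    ∀ {S} → IsIndependentSet E S → IsIndependentBroadcast E (characteristic S)
  characteristic-independent neighbour {S} independent = broadcast , separated
    where
    broadcast : IsBroadcast E (characteristic S)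
    broadcast v e (far , _) with neighbour v
    ... | u , v≢u , vu = ≤-trans (fromSide≤1 _) (far u 1 (adjacent⇒dist1 v≢u vu))

    separated : ∀ u v → u ≢ v → 0 < characteristic S u → 0 < characteristic S v →
      ∀ m → Dist E u v m → characteristic S u ⊔ characteristic S v < m
    separated u v u≢v χu χv m (r , _) =
      ≤-<-trans (⊔-lub (fromSide≤1 (lookup S u)) (fromSide≤1 (lookup S v))) (not-adjacent m r)
      where
      not-adjacent : ∀ m → Reach E m u v → 1 < m
      not-adjacent 0             r             = ⊥-elim (u≢v (reach-zero r))
      not-adjacent 1             (stay r)      = ⊥-elim (u≢v (reach-zero r))
      not-adjacent 1             (step here e) =
        ⊥-elim (independent u v (characteristic-pos⇒∈ S χu) (characteristic-pos⇒∈ S χv) u≢v e)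
      not-adjacent (suc (suc _)) _             = s≤s (s≤s z≤n)

-- Evenly spread sets

module Spread (n N : ℕ) .{{_ : NonZero n}} where

  floor : ℕ → ℕ
  floor i = i * N / n

  gap : ℕ → ℕ
  gap i = floor (suc i) ∸ floor i

  floor-suc : ∀ i → floor i ≤ floor (suc i)
  floor-suc i = /-monoˡ-≤ n (*-monoˡ-≤ N (n≤1+n i))

  sum<-gap : ∀ m → sum< m gap ≡ floor m
  sum<-gap zero    = sym (0/n≡0 n)
  sum<-gap (suc m) = begin
    sum< (suc m) gap  ≡⟨ sum<-snoc m gap ⟩
    sum< m gap + gap m ≡⟨ cong (_+ gap m) (sum<-gap m) ⟩
    floor m + gap m    ≡⟨ m+[n∸m]≡n (floor-suc m) ⟩
    floor (suc m)      ∎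
    where open ≡-Reasoning

  floor-n : floor n ≡ N
  floor-n = trans (cong (_/ n) (*-comm n N)) (m*n/n≡m N n)

  floor-+n : ∀ i → floor (i + n) ≡ N + floor i
  floor-+n i = begin
    (i + n) * N / n         ≡⟨ cong (_/ n) (*-distribʳ-+ N i n) ⟩
    (i * N + n * N) / n     ≡⟨ +-distrib-/-∣ʳ (i * N) (divides N (*-comm n N)) ⟩
    floor i + n * N / n     ≡⟨ cong (floor i +_) floor-n ⟩
    floor i + N             ≡⟨ +-comm (floor i) N ⟩
    N + floor i             ∎
    where open ≡-Reasoning

  gap-periodic : ∀ i → gap (i + n) ≡ gap i
  gap-periodic i =
    trans (cong₂ _∸_ (floor-+n (suc i)) (floor-+n i)) ([m+n]∸[m+o]≡n∸o N _ _)

  -- floor (u + t) - floor u depends on u only through u * N % n.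
  floorFrom : ℕ → ℕ → ℕ
  floorFrom u t = (u * N % n + t * N) / n

  floor-+ : ∀ u t → floor (u + t) ≡ floor u + floorFrom u t
  floor-+ u t = begin
    (u + t) * N / n                                     ≡⟨ cong (_/ n) (*-distribʳ-+ N u t) ⟩
    (u * N + t * N) / n                                 ≡⟨ cong (λ x → (x + t * N) / n) (m≡m%n+[m/n]*n (u * N) n) ⟩
    (u * N % n + floor u * n + t * N) / n               ≡⟨ cong (_/ n) (xy∙z≈xz∙y (u * N % n) _ _) ⟩
    (u * N % n + t * N + floor u * n) / n               ≡⟨ +-distrib-/-∣ʳ _ (divides (floor u) refl) ⟩
    floorFrom u t + floor u * n / n                     ≡⟨ cong (floorFrom u t +_) (m*n/n≡m (floor u) n) ⟩
    floorFrom u t + floor u                             ≡⟨ +-comm _ (floor u) ⟩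
    floor u + floorFrom u t                             ∎
    where open ≡-Reasoning

  gap-+ : ∀ u t → gap (u + t) ≡ floorFrom u (suc t) ∸ floorFrom u t
  gap-+ u t = begin
    floor (suc (u + t)) ∸ floor (u + t)                ≡⟨ cong (λ x → floor x ∸ floor (u + t)) (+-suc u t) ⟨
    floor (u + suc t) ∸ floor (u + t)                  ≡⟨ cong₂ _∸_ (floor-+ u (suc t)) (floor-+ u t) ⟩
    floor u + floorFrom u (suc t) ∸ (floor u + floorFrom u t) ≡⟨ [m+n]∸[m+o]≡n∸o (floor u) _ _ ⟩
    floorFrom u (suc t) ∸ floorFrom u t                ∎
    where open ≡-Reasoning

  gap-pos : ∀ u t → 0 < gap (u + t) → floorFrom u t < floorFrom u (suc t)
  gap-pos u t pos = m∸n≢0⇒n<m (λ zero-gap → <⇒≢ pos (sym (trans (gap-+ u t) zero-gap)))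

  gap≤1 : N ≤ n → ∀ i → gap i ≤ 1
  gap≤1 N≤n i = begin
    gap i                        ≡⟨ cong gap (+-identityʳ i) ⟨
    gap (i + 0)                  ≡⟨ gap-+ i 0 ⟩
    floorFrom i 1 ∸ floorFrom i 0 ≤⟨ m∸n≤m _ (floorFrom i 0) ⟩
    floorFrom i 1                ≤⟨ ≤-pred (m<n*o⇒m/o<n below-2n) ⟩
    1                            ∎
    where
    open ≤-Reasoning
    below-2n : i * N % n + 1 * N < 2 * n
    below-2n = subst₂ _<_ (cong (i * N % n +_) (sym (*-identityˡ N))) (cong (n +_) (sym (+-identityʳ n)))
                 (+-mono-<-≤ (m%n<n (i * N) n) N≤n)

  1≤floorFrom : ∀ u → 0 < gap u → 1 ≤ floorFrom u 1
  1≤floorFrom u pos =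
    ≤-trans (s≤s z≤n) (gap-pos u 0 (subst (λ x → 0 < gap x) (sym (+-identityʳ u)) pos))

  gaps-1-apart : 2 * N < n → ∀ u → 0 < gap u → 0 < gap (u + 1) → ⊥
  gaps-1-apart 2N<n u first second = <⇒≱ below (≤/⇒*≤ n 2≤)
    where
    2≤ : 2 ≤ floorFrom u 2
    2≤ = ≤-trans (s≤s (1≤floorFrom u first)) (gap-pos u 1 second)
    below : u * N % n + 2 * N < 2 * n
    below = subst (u * N % n + 2 * N <_) (cong (n +_) (sym (+-identityʳ n)))
              (+-mono-<-≤ (m%n<n (u * N) n) (<⇒≤ 2N<n))

  gaps-4-apart : N * 5 ≤ 2 * n → n ≤ 3 * N → ∀ u → 0 < gap u → 0 < gap (u + 4) → ⊥
  gaps-4-apart 5N≤2n n≤3N u first second = <⇒≱ below (≤/⇒*≤ n 3≤)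
    where
    r = u * N % n
    n≤r+N : n ≤ r + N
    n≤r+N = subst₂ _≤_ (*-identityˡ n) (cong (r +_) (*-identityˡ N))
              (≤/⇒*≤ n (1≤floorFrom u first))
    2≤ : 2 ≤ floorFrom u 4
    2≤ = *≤⇒≤/ n (begin
      2 * n         ≡⟨ cong (n +_) (+-identityʳ n) ⟩
      n + n         ≤⟨ +-mono-≤ n≤r+N n≤3N ⟩
      r + N + 3 * N ≡⟨ regroup r N ⟩
      r + 4 * N     ∎)
      where
      open ≤-Reasoning
      regroup : ∀ r N → r + N + 3 * N ≡ r + 4 * N
      regroup = solve-∀
    3≤ : 3 ≤ floorFrom u 5
    3≤ = ≤-trans (s≤s 2≤) (gap-pos u 4 second)
    below : r + 5 * N < 3 * n
    below = +-mono-<-≤ (m%n<n (u * N) n) (subst (_≤ 2 * n) (*-comm N 5) 5N≤2n)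

-- The circulant graph C(n;1,4)

hops : ℕ → ℕ
hops 0                           = 0
hops 1                           = 1
hops 2                           = 2
hops 3                           = 2
hops (suc (suc (suc (suc g)))) = suc (hops g)

4*hops≤+6 : ∀ g → 4 * hops g ≤ g + 6
4*hops≤+6 0                           = z≤n
4*hops≤+6 1                           = s≤s (s≤s (s≤s (s≤s z≤n)))
4*hops≤+6 2                           = ≤-refl
4*hops≤+6 3                           = n≤1+n _
4*hops≤+6 (suc (suc (suc (suc g)))) =
  subst (_≤ 4 + (g + 6)) (sym (*-suc 4 (hops g))) (+-monoʳ-≤ 4 (4*hops≤+6 g))

<hops⇒4*≤+2 : ∀ {k g} → k < hops g → 4 * k ≤ g + 2
<hops⇒4*≤+2 {k} {g} k<hops = +-cancelʳ-≤ 4 _ _ (begin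
  4 * k + 4     ≡⟨ +-comm (4 * k) 4 ⟩
  4 + 4 * k     ≡⟨ *-suc 4 k ⟨
  4 * suc k     ≤⟨ *-monoʳ-≤ 4 k<hops ⟩
  4 * hops g    ≤⟨ 4*hops≤+6 g ⟩
  g + 6         ≡⟨ +-assoc g 2 4 ⟨
  g + 2 + 4     ∎)
  where open ≤-Reasoning

-- Charges at j₁ < j₂ < j₃ = j₁ + d₁ + d₂ to one base, with strengths k₁ at j₁ and k₃ at j₃.
three-in-a-window : ∀ {k₁ k₃ d₁ d₂} → 0 < k₁ → d₁ + d₂ < 2 * k₁ + 3 * k₃ →
  4 * k₁ ≤ d₁ + 2 → 4 * k₃ ≤ d₂ + 2 → k₁ < hops (d₁ + d₂) → ⊥
three-in-a-window {k₁} {k₃} {d₁} {d₂} 0<k₁ short wide₁ wide₃ =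
  cases k₁ k₃ 0<k₁ small short wide₁ wide₃
  where
  open ≤-Reasoning
  regroup : ∀ k₁ k₃ → 4 * k₁ + 4 * k₃ ≡ 2 * k₁ + k₃ + (2 * k₁ + 3 * k₃)
  regroup = solve-∀
  small : 2 * k₁ + k₃ < 4
  small = +-cancelʳ-< (2 * k₁ + 3 * k₃) _ _ (begin-strict
    2 * k₁ + k₃ + (2 * k₁ + 3 * k₃) ≡⟨ regroup k₁ k₃ ⟨
    4 * k₁ + 4 * k₃                 ≤⟨ +-mono-≤ wide₁ wide₃ ⟩
    d₁ + 2 + (d₂ + 2)               ≡⟨ interchange d₁ 2 d₂ 2 ⟩
    d₁ + d₂ + 4                     <⟨ +-monoˡ-< 4 short ⟩
    2 * k₁ + 3 * k₃ + 4             ≡⟨ +-comm _ 4 ⟩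
    4 + (2 * k₁ + 3 * k₃)           ∎)
  cases : ∀ k₁ k₃ {d₁ d₂} → 0 < k₁ → 2 * k₁ + k₃ < 4 → d₁ + d₂ < 2 * k₁ + 3 * k₃ →
    4 * k₁ ≤ d₁ + 2 → 4 * k₃ ≤ d₂ + 2 → k₁ < hops (d₁ + d₂) → ⊥
  cases 1 0 {d₁} {d₂} _ _ short wide₁ _ _ =
    <⇒≱ short (≤-trans (+-cancelʳ-≤ 2 2 d₁ wide₁) (m≤m+n d₁ d₂))
  cases 1 1 {d₁} {d₂} _ _ short wide₁ wide₃ apart =
    <-irrefl refl (subst (λ d → 1 < hops d) d₁+d₂≡4 apart)
    where
    d₁+d₂≡4 : d₁ + d₂ ≡ 4
    d₁+d₂≡4 = ≤-antisym (≤-pred short) (+-mono-≤ (+-cancelʳ-≤ 2 2 d₁ wide₁) (+-cancelʳ-≤ 2 2 d₂ wide₃))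
  cases 1 (suc (suc _)) _ (s≤s (s≤s (s≤s (s≤s ())))) _ _ _ _
  cases (suc (suc k₁)) k₃ _ small _ _ _ _ =
    <⇒≱ small (≤-trans (*-monoʳ-≤ 2 (s≤s (s≤s (z≤n {k₁})))) (m≤m+n _ k₃))

module Circulant (n : ℕ) (4<n : 4 < n) where

  instance
    n-nonZero : NonZero n
    n-nonZero = >-nonZero (<-trans z<s 4<n)

  C : Fin n → Fin n → Set
  C = CircAdj n 4

  1<n : 1 < n
  1<n = <-trans (s≤s (s≤s z≤n)) 4<n

  vertex : ℕ → Fin n
  vertex m = m mod n

  toℕ-vertex : ∀ m → toℕ (vertex m) ≡ m % n
  toℕ-vertex m = Fin.toℕ-fromℕ< (m%n<n m n)

  vertex-toℕ : ∀ i → vertex (toℕ i) ≡ i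
  vertex-toℕ i = Fin.toℕ-injective (trans (toℕ-vertex (toℕ i)) (m<n⇒m%n≡m (Fin.toℕ<n i)))

  vertex-+n : ∀ m → vertex (m + n) ≡ vertex m
  vertex-+n m = Fin.toℕ-injective
    (trans (toℕ-vertex (m + n)) (trans ([m+n]%n≡m%n m n) (sym (toℕ-vertex m))))

  toℕ-vertex-+ : ∀ m {s} → s < n → toℕ (vertex (m + s)) ≡ (toℕ (vertex m) + s) % n
  toℕ-vertex-+ m {s} s<n = begin
    toℕ (vertex (m + s))     ≡⟨ toℕ-vertex (m + s) ⟩
    (m + s) % n              ≡⟨ %-distribˡ-+ m s n ⟩
    (m % n + s % n) % n      ≡⟨ cong (λ x → (m % n + x) % n) (m<n⇒m%n≡m s<n) ⟩
    (m % n + s) % n          ≡⟨ cong (λ x → (x + s) % n) (toℕ-vertex m) ⟨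
    (toℕ (vertex m) + s) % n ∎
    where open ≡-Reasoning

  plus-step : ∀ m {s} → s < n → PlusStep n s (vertex m) (vertex (m + s))
  plus-step m s<n with %-of-<2* n (+-mono-<-≤ (Fin.toℕ<n (vertex m)) (<⇒≤ s<n))
  ... | inj₁ no-wrap = inj₁ (trans (sym no-wrap) (sym (toℕ-vertex-+ m s<n)))
  ... | inj₂ wrap    = inj₂ (trans (sym wrap) (cong (_+ n) (sym (toℕ-vertex-+ m s<n))))

  +1-adjacent : ∀ a b → b ≡ a + 1 → C (vertex a) (vertex b)
  +1-adjacent a _ refl = inj₁ (plus-step a 1<n)

  -1-adjacent : ∀ a b → a ≡ b + 1 → C (vertex a) (vertex b)
  -1-adjacent _ b refl = inj₂ (inj₁ (plus-step b 1<n))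

  +4-adjacent : ∀ a b → b ≡ a + 4 → C (vertex a) (vertex b)
  +4-adjacent a _ refl = inj₂ (inj₂ (inj₁ (plus-step a 4<n)))

  -4-adjacent : ∀ a b → a ≡ b + 4 → C (vertex a) (vertex b)
  -4-adjacent _ b refl = inj₂ (inj₂ (inj₂ (plus-step b 4<n)))

  forward : ∀ g m → Reach C (hops g) (vertex m) (vertex (m + g))
  forward 0 m = subst (Reach C 0 (vertex m) ∘ vertex) (sym (+-identityʳ m)) here
  forward 1 m = step here (+1-adjacent m (m + 1) refl)
  forward 2 m = step (forward 1 m) (+1-adjacent (m + 1) (m + 2) (sym (+-assoc m 1 1)))
  forward 3 m = step (step here (+4-adjacent m (m + 4) refl))
                     (-1-adjacent (m + 4) (m + 3) (sym (+-assoc m 3 1)))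
  forward (suc (suc (suc (suc g)))) m = step (forward g m)
    (+4-adjacent (m + g) _ (trans (cong (m +_) (+-comm 4 g)) (sym (+-assoc m g 4))))

  backward : ∀ g m → Reach C (hops g) (vertex (m + g)) (vertex m)
  backward 0 m = subst (λ a → Reach C 0 (vertex a) (vertex m)) (sym (+-identityʳ m)) here
  backward 1 m = step here (-1-adjacent (m + 1) m refl)
  backward 2 m = step (step here (-1-adjacent (m + 2) (m + 1) (sym (+-assoc m 1 1))))
                      (-1-adjacent (m + 1) m refl)
  backward 3 m = step (step here (+1-adjacent (m + 3) (m + 4) (sym (+-assoc m 3 1))))
                      (-4-adjacent (m + 4) m refl)
  backward (suc (suc (suc (suc g)))) m = step
    (subst (λ a → Reach C (hops g) (vertex a) (vertex (m + 4))) (+-assoc m 4 g) (backward g (m + 4)))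
    (-4-adjacent (m + 4) m refl)

  vertex-≢-+ : ∀ a {d} → 0 < d → d < n → vertex a ≢ vertex (a + d)
  vertex-≢-+ a {d} 0<d d<n same with plus-step a d<n
  ... | inj₁ no-wrap = <⇒≢ (m<m+n _ 0<d) (trans (cong toℕ same) (sym no-wrap))
  ... | inj₂ wrap    = <⇒≢ d<n (+-cancelˡ-≡ _ _ _ (trans wrap (cong (λ v → toℕ v + n) (sym same))))

  offset : ∀ p q → ∃ λ d → d < n × vertex (toℕ p + d) ≡ q
  offset p q with toℕ p ≤? toℕ q
  ... | yes p≤q = toℕ q ∸ toℕ p , ≤-<-trans (m∸n≤m (toℕ q) (toℕ p)) (Fin.toℕ<n q) ,
                  trans (cong vertex (m+[n∸m]≡n p≤q)) (vertex-toℕ q)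
  ... | no  p≰q = toℕ q + n ∸ toℕ p , m<n+o⇒m∸n<o _ (toℕ p) wrap<n ,
                  trans (cong vertex (m+[n∸m]≡n p≤q+n)) (trans (vertex-+n (toℕ q)) (vertex-toℕ q))
    where
    p≤q+n : toℕ p ≤ toℕ q + n
    p≤q+n = ≤-trans (<⇒≤ (Fin.toℕ<n p)) (m≤n+m n (toℕ q))
    wrap<n : toℕ q + n < toℕ p + n
    wrap<n = +-monoˡ-< n (≰⇒> p≰q)

  reach-forward : ∀ {p q d} → vertex (toℕ p + d) ≡ q → Reach C (hops d) p q
  reach-forward {p} {d = d} refl =
    subst (λ v → Reach C (hops d) v (vertex (toℕ p + d))) (vertex-toℕ p) (forward d (toℕ p))

  reach-backward : ∀ {p q d} → d ≤ n → vertex (toℕ p + d) ≡ q → Reach C (hops (n ∸ d)) p q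
  reach-backward {p} {d = d} d≤n refl =
    subst (λ v → Reach C (hops (n ∸ d)) v (vertex (toℕ p + d))) around (backward (n ∸ d) (toℕ p + d))
    where
    around : vertex (toℕ p + d + (n ∸ d)) ≡ p
    around = trans (cong vertex (trans (+-assoc (toℕ p) d (n ∸ d)) (cong (toℕ p +_) (m+[n∸m]≡n d≤n))))
                   (trans (vertex-+n (toℕ p)) (vertex-toℕ p))

  neighbour : ∀ v → ∃ λ u → v ≢ u × C v u
  neighbour v = vertex (toℕ v + 1) ,
    subst (λ w → w ≢ vertex (toℕ v + 1)) (vertex-toℕ v) (vertex-≢-+ (toℕ v) z<s 1<n) ,
    subst (λ w → C w (vertex (toℕ v + 1))) (vertex-toℕ v) (+1-adjacent (toℕ v) _ refl)

-- Bounds on C(n;1,4) for n ≥ 8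

module Bounds (n : ℕ) (8≤n : 8 ≤ n) where

  open Circulant n (≤-trans (s≤s (s≤s (s≤s (s≤s (s≤s z≤n))))) 8≤n) public

  N : ℕ
  N = 2 * n / 5

  5N≤2n : N * 5 ≤ 2 * n
  5N≤2n = m/n*n≤m (2 * n) 5

  2N<n : 2 * N < n
  2N<n = *-cancelˡ-< 5 _ _ (begin-strict
    5 * (2 * N) ≡⟨ regroup N ⟩
    2 * (N * 5) ≤⟨ *-monoʳ-≤ 2 5N≤2n ⟩
    2 * (2 * n) ≡⟨ *-assoc 2 2 n ⟨
    4 * n       <⟨ *-monoˡ-< n (n<1+n 4) ⟩
    5 * n       ∎)
    where
    open ≤-Reasoning
    regroup : ∀ N → 5 * (2 * N) ≡ 2 * (N * 5)
    regroup = solve-∀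

  hops≤N : ∀ {g} → 2 * g ≤ n → hops g ≤ N
  hops≤N {g} 2g≤n = *≤⇒≤/ {m = 2 * n} 5 (*-cancelˡ-≤ 8 (begin
    8 * (hops g * 5)  ≡⟨ regroup₁ (hops g) ⟩
    10 * (4 * hops g) ≤⟨ *-monoʳ-≤ 10 (4*hops≤+6 g) ⟩
    10 * (g + 6)      ≡⟨ regroup₂ g ⟩
    5 * (2 * g) + 60  ≤⟨ +-mono-≤ (*-monoʳ-≤ 5 2g≤n) (≤-trans (m≤m+n 60 28) (*-monoʳ-≤ 11 8≤n)) ⟩
    5 * n + 11 * n    ≡⟨ regroup₃ n ⟩
    8 * (2 * n)       ∎))
    where
    open ≤-Reasoning
    regroup₁ : ∀ h → 8 * (h * 5) ≡ 10 * (4 * h)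
    regroup₁ = solve-∀
    regroup₂ : ∀ g → 10 * (g + 6) ≡ 5 * (2 * g) + 60
    regroup₂ = solve-∀
    regroup₃ : ∀ n → 5 * n + 11 * n ≡ 8 * (2 * n)
    regroup₃ = solve-∀

  radius : ∀ v u → Reach C N v u
  radius v u with offset v u
  ... | d , d<n , v+d≡u with 2 * d ≤? n
  ...   | yes 2d≤n = reach-mono (hops≤N 2d≤n) (reach-forward v+d≡u)
  ...   | no  2d≰n = reach-mono (hops≤N (<⇒≤ 2[n∸d]<n)) (reach-backward (<⇒≤ d<n) v+d≡u)
    where
    2[n∸d]<n : 2 * (n ∸ d) < n
    2[n∸d]<n = subst (_< n) (sym (*-distribˡ-∸ 2 n d))
      (m<n+o⇒m∸n<o (2 * n) (2 * d)
        (subst (_< 2 * d + n) (cong (n +_) (sym (+-identityʳ n))) (+-monoˡ-< n (≰⇒> 2d≰n))))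

  A : ℕ
  A = 2 * (n / 5)

  -- A vertex of strength k at position y + j is charged to the base y when
  -- A - 2k ≤ j < A + 3k.  It is charged to 5k bases, while independence lets no base
  -- receive three charges; hence 5σ(f) ≤ 2n.
  charge : ℕ → ℕ → ℕ
  charge k = indicator (A ∸ 2 * k) (A + 3 * k)

  charge-pos : ∀ {k j} → 0 < charge k j → 0 < k × A ≤ j + 2 * k × j < A + 3 * k
  charge-pos {zero}  {j} pos with indicator-pos pos
  ... | A≤j , j<A+0 = ⊥-elim (<⇒≱ (subst (j <_) (+-identityʳ A) j<A+0) A≤j)
  charge-pos {suc k} {j} pos with indicator-pos pos
  ... | lo , hi = z<s , A≤ , hi
    where
    A≤ : A ≤ j + 2 * suc k
    A≤ = ≤-trans (m≤n+m∸n A (2 * suc k))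
           (subst (2 * suc k + (A ∸ 2 * suc k) ≤_) (+-comm (2 * suc k) j) (+-monoʳ-≤ (2 * suc k) lo))

  5k≤sum<-charge : ∀ {k} → 5 * k ≤ n → 5 * k ≤ sum< n (charge k)
  5k≤sum<-charge {k} 5k≤n = begin
    5 * k                            ≡⟨ m+n∸m≡n (A ∸ 2 * k) (5 * k) ⟨
    A ∸ 2 * k + 5 * k ∸ (A ∸ 2 * k)  ≡⟨ cong (_∸ (A ∸ 2 * k)) window-end ⟨
    A + 3 * k ∸ (A ∸ 2 * k)          ≡⟨ sum<-indicator _ _ (A + 3 * k) ≤-refl ⟨
    sum< (A + 3 * k) (charge k)      ≤⟨ sum<-monoˡ-≤ (charge k) window-inside ⟩
    sum< n (charge k)                ∎
    where
    open ≤-Reasoning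
    k≤n/5 : k ≤ n / 5
    k≤n/5 = *≤⇒≤/ 5 (subst (_≤ n) (*-comm 5 k) 5k≤n)
    window-inside : A + 3 * k ≤ n
    window-inside = ≤-trans (+-monoʳ-≤ A (*-monoʳ-≤ 3 k≤n/5))
                      (≤-trans (≤-reflexive (regroup (n / 5))) (m/n*n≤m n 5))
      where
      regroup : ∀ K → 2 * K + 3 * K ≡ K * 5
      regroup = solve-∀
    window-end : A + 3 * k ≡ A ∸ 2 * k + 5 * k
    window-end = trans (cong (_+ 3 * k) (sym (m∸n+n≡m (*-monoʳ-≤ 2 k≤n/5)))) (regroup (A ∸ 2 * k) k)
      where
      regroup : ∀ x k → x + 2 * k + 3 * k ≡ x + 5 * k
      regroup = solve-∀

  module UpperBound (f : Fin n → ℕ) (independent : IsIndependentBroadcast C f) where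

    strong⇒alone : ∀ p → n < 5 * f p → ∀ q → q ≢ p → f q ≡ 0
    strong⇒alone p strong q q≢p with f q in fq
    ... | zero  = refl
    ... | suc _ with offset p q
    ...   | d , d<n , p+d≡q = ⊥-elim (<⇒≱ (≤-trans (m≤m+n 13 11) (*-monoʳ-≤ 3 8≤n)) 3n≤12)
      where
      fp>0 : 0 < f p
      fp>0 with f p
      ... | suc _ = z<s
      ... | zero  = ⊥-elim (<⇒≱ strong z≤n)
      fp<hops : ∀ {l} → Reach C l p q → f p < l
      fp<hops = m⊔n<o⇒m<o _ _ ∘
        independent-reach independent (q≢p ∘ sym) fp>0 (subst (0 <_) (sym fq) z<s)
      8fp≤n+4 : 4 * f p + 4 * f p ≤ n + 4
      8fp≤n+4 = begin
        4 * f p + 4 * f p   ≤⟨ +-mono-≤ (<hops⇒4*≤+2 (fp<hops (reach-forward p+d≡q)))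
                                         (<hops⇒4*≤+2 (fp<hops (reach-backward (<⇒≤ d<n) p+d≡q))) ⟩
        d + 2 + (n ∸ d + 2) ≡⟨ interchange d 2 (n ∸ d) 2 ⟩
        d + (n ∸ d) + 4     ≡⟨ cong (_+ 4) (m+[n∸m]≡n (<⇒≤ d<n)) ⟩
        n + 4               ∎
        where open ≤-Reasoning
      3n≤12 : 3 * n ≤ 12
      3n≤12 = +-cancelʳ-≤ (5 * n + 8) _ _ (begin
        3 * n + (5 * n + 8)     ≡⟨ regroup₁ n ⟩
        8 * suc n               ≤⟨ *-monoʳ-≤ 8 strong ⟩
        8 * (5 * f p)           ≡⟨ regroup₂ (f p) ⟩
        5 * (4 * f p + 4 * f p) ≤⟨ *-monoʳ-≤ 5 8fp≤n+4 ⟩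
        5 * (n + 4)             ≡⟨ regroup₃ n ⟩
        12 + (5 * n + 8)        ∎)
        where
        open ≤-Reasoning
        regroup₁ : ∀ n → 3 * n + (5 * n + 8) ≡ 8 * suc n
        regroup₁ = solve-∀
        regroup₂ : ∀ k → 8 * (5 * k) ≡ 5 * (4 * k + 4 * k)
        regroup₂ = solve-∀
        regroup₃ : ∀ n → 5 * (n + 4) ≡ 12 + (5 * n + 8)
        regroup₃ = solve-∀

    F : ℕ → ℕ
    F m = f (vertex m)

    charges : ℕ → ℕ → ℕ
    charges y j = charge (F (y + j)) j

    separated : ∀ y {i j} → i < j → j < n → 0 < F (y + i) → 0 < F (y + j) →
      F (y + i) ⊔ F (y + j) < hops (j ∸ i)
    separated y {i} {j} i<j j<n Fi>0 Fj>0 = independent-reach independent distinct Fi>0 Fj>0 walk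
      where
      shift : y + i + (j ∸ i) ≡ y + j
      shift = trans (+-assoc y i _) (cong (y +_) (m+[n∸m]≡n (<⇒≤ i<j)))
      distinct : vertex (y + i) ≢ vertex (y + j)
      distinct = subst (λ x → vertex (y + i) ≢ vertex x) shift
        (vertex-≢-+ (y + i) (m<n⇒0<n∸m i<j) (≤-<-trans (m∸n≤m j i) j<n))
      walk : Reach C (hops (j ∸ i)) (vertex (y + i)) (vertex (y + j))
      walk = subst (Reach C (hops (j ∸ i)) (vertex (y + i)) ∘ vertex) shift (forward (j ∸ i) (y + i))

    no-three-charges : ∀ y {j₁ j₂ j₃} → j₁ < j₂ → j₂ < j₃ → j₃ < n →
      0 < charges y j₁ → 0 < charges y j₂ → 0 < charges y j₃ → ⊥
    no-three-charges y {j₁} {j₂} {j₃} j₁<j₂ j₂<j₃ j₃<n c₁ c₂ c₃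
      with charge-pos c₁ | charge-pos c₂ | charge-pos c₃
    ... | k₁>0 , A≤j₁+2k₁ , _ | k₂>0 , _ | k₃>0 , _ , j₃<A+3k₃ = three-in-a-window {k₁} {k₃} {d₁} {d₂} k₁>0 short
      (<hops⇒4*≤+2 (m⊔n<o⇒m<o k₁ (F (y + j₂)) (separated y j₁<j₂ (<-trans j₂<j₃ j₃<n) k₁>0 k₂>0)))
      (<hops⇒4*≤+2 (m⊔n<o⇒n<o (F (y + j₂)) k₃ (separated y j₂<j₃ j₃<n k₂>0 k₃>0)))
      (subst (λ d → F (y + j₁) < hops d) span
        (m⊔n<o⇒m<o _ _ (separated y (<-trans j₁<j₂ j₂<j₃) j₃<n k₁>0 k₃>0)))
      where
      k₁ = F (y + j₁)
      k₃ = F (y + j₃)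
      d₁ = j₂ ∸ j₁
      d₂ = j₃ ∸ j₂
      j₁+d₁+d₂≡j₃ : j₁ + (d₁ + d₂) ≡ j₃
      j₁+d₁+d₂≡j₃ = trans (sym (+-assoc j₁ d₁ d₂))
        (trans (cong (_+ d₂) (m+[n∸m]≡n (<⇒≤ j₁<j₂))) (m+[n∸m]≡n (<⇒≤ j₂<j₃)))
      span : j₃ ∸ j₁ ≡ d₁ + d₂
      span = trans (cong (_∸ j₁) (sym j₁+d₁+d₂≡j₃)) (m+n∸m≡n j₁ (d₁ + d₂))
      short : d₁ + d₂ < 2 * k₁ + 3 * k₃
      short = subst₂ _<_ span (m+n∸m≡n j₁ _)
        (∸-monoˡ-< (<-≤-trans j₃<A+3k₃ (≤-trans (+-monoˡ-≤ (3 * k₃) A≤j₁+2k₁)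
                                           (≤-reflexive (+-assoc j₁ _ _))))
                   (<⇒≤ (<-trans j₁<j₂ j₂<j₃)))

    charges≤2 : ∀ y → sum< n (charges y) ≤ 2
    charges≤2 y = ≮⇒≥ λ 2<sum →
      let j₃ , j₃<n , c₃ , 2≤ = sum<-last-support n (charges y) 0/1 2 2<sum
          j₂ , j₂<j₃ , c₂ , 1≤ = sum<-last-support j₃ (charges y) 0/1 1 2≤
          j₁ , j₁<j₂ , c₁ , _ = sum<-last-support j₂ (charges y) 0/1 0 1≤
      in no-three-charges y j₁<j₂ j₂<j₃ j₃<n c₁ c₂ c₃
      where
      0/1 : ∀ j → charges y j ≤ 1
      0/1 j = indicator≤1 _ _ j

    weak-cost : (∀ p → 5 * f p ≤ n) → cost C f ≤ N
    weak-cost weak = *≤⇒≤/ 5 (begin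
      sum (tabulate f) * 5                         ≡⟨ *-comm (sum (tabulate f)) 5 ⟩
      5 * sum (tabulate f)                         ≡⟨ cong (5 *_) (sum-tabulate f F (cong f ∘ sym ∘ vertex-toℕ)) ⟩
      5 * sum< n F                                 ≡⟨ *-distribˡ-sum< n 5 F ⟩
      ∑[ x < n ] (5 * F x)                         ≤⟨ sum<-mono-≤ n (λ x _ → 5k≤sum<-charge {F x} (weak (vertex x))) ⟩
      ∑[ x < n ] ∑[ j < n ] charge (F x) j         ≡⟨ sum<-comm n n (λ x j → charge (F x) j) ⟩
      ∑[ j < n ] ∑[ x < n ] charge (F x) j         ≡⟨ sum<-cong n (λ j _ → sym (sum<-rotate n _ (periodic j) j)) ⟩
      ∑[ j < n ] ∑[ y < n ] charge (F (y + j)) j   ≡⟨ sum<-comm n n charges ⟨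
      ∑[ y < n ] sum< n (charges y)                ≤⟨ sum<-mono-≤ n (λ y _ → charges≤2 y) ⟩
      ∑[ y < n ] 2                                 ≡⟨ sum<-const n 2 ⟩
      n * 2                                        ≡⟨ *-comm n 2 ⟩
      2 * n                                        ∎)
      where
      open ≤-Reasoning
      periodic : ∀ j x → charge (F (x + n)) j ≡ charge (F x) j
      periodic j x = cong (λ v → charge (f v) j) (vertex-+n x)

    upper-bound : cost C f ≤ N
    upper-bound with Fin.any? (λ p → n <? 5 * f p)
    ... | yes (p , strong) = subst (_≤ N) (sym (sum-tabulate-single f p (strong⇒alone p strong)))
                               (broadcast≤radius (proj₁ independent) (radius p))
    ... | no  no-strong    = weak-cost (λ p → ≮⇒≥ (λ strong → no-strong (p , strong)))

  open Spread n N using (floor; gap; floor-n; sum<-gap; gap≤1; gap-periodic; gaps-1-apart; gaps-4-apart)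

  spread : Subset n
  spread = Vec.tabulate (positive ∘ gap ∘ toℕ)

  ∈spread⇒gap>0 : ∀ {i} → i ∈ spread → 0 < gap (toℕ i)
  ∈spread⇒gap>0 {i} i∈ with gap (toℕ i) | trans (sym (lookup∘tabulate (positive ∘ gap ∘ toℕ) i)) ([]=⇒lookup i∈)
  ... | suc _ | _ = z<s

  ∣spread∣≡N : ∣ spread ∣ ≡ N
  ∣spread∣≡N = begin
    ∣ spread ∣                              ≡⟨ sum-characteristic spread ⟨
    sum (tabulate (characteristic spread)) ≡⟨ sum-tabulate (characteristic spread) (fromSide ∘ positive ∘ gap)
                                                 (cong fromSide ∘ lookup∘tabulate (positive ∘ gap ∘ toℕ)) ⟩
    sum< n (fromSide ∘ positive ∘ gap)      ≡⟨ sum<-cong n (λ i _ → fromSide-positive (gap≤1 N≤n i)) ⟩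
    sum< n gap                              ≡⟨ sum<-gap n ⟩
    floor n                                 ≡⟨ floor-n ⟩
    N                                       ∎
    where
    open ≡-Reasoning
    N≤n : N ≤ n
    N≤n = ≤-trans (m≤n+m N N) (≤-trans (≤-reflexive (cong (N +_) (sym (+-identityʳ N)))) (<⇒≤ 2N<n))

  step-between-spread : ∀ {s} → s ≡ 1 ⊎ s ≡ 4 → ∀ {a b} → PlusStep n s a b → a ∈ spread → b ∈ spread → ⊥
  step-between-spread {s} s∈ {a} {b} a+s≡b a∈ b∈ = apart s∈ (toℕ a) (∈spread⇒gap>0 a∈) (gap>0 a+s≡b)
    where
    apart : ∀ {s} → s ≡ 1 ⊎ s ≡ 4 → ∀ u → 0 < gap u → 0 < gap (u + s) → ⊥
    apart (inj₁ refl) = gaps-1-apart 2N<n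
    apart (inj₂ refl) = gaps-4-apart 5N≤2n (n≤3*[2n/5] 8≤n)
    gap>0 : PlusStep n s a b → 0 < gap (toℕ a + s)
    gap>0 (inj₁ eq) = subst (λ x → 0 < gap x) (sym eq) (∈spread⇒gap>0 b∈)
    gap>0 (inj₂ eq) = subst (λ x → 0 < gap x) (sym eq)
                      (subst (0 <_) (sym (gap-periodic (toℕ b))) (∈spread⇒gap>0 b∈))

  spread-independent : IsIndependentSet C spread
  spread-independent u v u∈ v∈ _ (inj₁ p)               = step-between-spread (inj₁ refl) p u∈ v∈
  spread-independent u v u∈ v∈ _ (inj₂ (inj₁ p))        = step-between-spread (inj₁ refl) p v∈ u∈
  spread-independent u v u∈ v∈ _ (inj₂ (inj₂ (inj₁ p))) = step-between-spread (inj₂ refl) p u∈ v∈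
  spread-independent u v u∈ v∈ _ (inj₂ (inj₂ (inj₂ p))) = step-between-spread (inj₂ refl) p v∈ u∈

theorem20 : (n : ℕ) → 8 ≤ n →
    BroadcastIndependenceNumber (CircAdj n 4) ((2 * n) / 5) ×
    IndependenceNumber (CircAdj n 4) ((2 * n) / 5)
theorem20 n 8≤n =
  ( (characteristic spread , characteristic-independent neighbour spread-independent
    , trans (sum-characteristic spread) ∣spread∣≡N)
  , UpperBound.upper-bound )
  , ( (spread , spread-independent , ∣spread∣≡N)
    , λ S independent → subst (_≤ N) (sum-characteristic S)
        (UpperBound.upper-bound _ (characteristic-independent neighbour independent)) )
  where open Bounds n 8≤n
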